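{- Let $m\ge 0$ be an integer, and let $\lambda$ be a partition with $m$-Durfee rectangle symbol $(\alpha,\beta)_{(m+j)\times j}$. For every integer $k$ with $1\le k\le m-1$, we have $\lambda_k>\lambda_{k+1}$ if and only if $k$ is a part of $\alpha$.
   Context: For a partition $\lambda=(\lambda_1\ge\cdots\ge\lambda_{\ell(\lambda)}\ge1)$, set $\lambda_k=0$ for $k>\ell(\lambda)$. The conjugate $\lambda'$ is given by $\lambda'_i=\#\{r:\lambda_r\ge i\}$. $m$-Durfee rectangle symbol. If $\ell(\lambda)\ge m+1$, let $$j=\max\{k:1\le k\le\ell(\lambda),\ \lambda_{k+m}\ge k\};$$ otherwise let $j=0$. Then $$\alpha=(\lambda_1-j,\ldots,\lambda_{m+j}-j)',$$ the conjugate of the partition formed by the positive entries, and $$\beta=(\lambda_{m+j+1},\ldots,\lambda_{\ell(\lambda)}).$$ In particular, if $j=0$ then $\alpha=\lambda'$ and $\beta=\emptyset$. -}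

module Defs where

open import Data.Nat using (ℕ; zero; suc; _+_; _∸_; _≤_; _≤?_; _≥_; _⊔_)
open import Data.List using (List; []; _∷_; length; map; filter; upTo; foldr)
open import Data.List.Relation.Unary.All using (All)
open import Data.List.Relation.Unary.Linked using (Linked)
open import Data.Product using (_×_)
open import Relation.Nullary.Decidable using (yes; no)

IsPartition : List ℕ → Set
IsPartition λs = All (λ x → 1 ≤ x) λs × Linked _≥_ λs

-- 1-indexed part λ_k, with λ_k = 0 for k > ℓ(λ) (index 0 is unused; returns 0).
part : List ℕ → ℕ → ℕ
part [] _ = 0
part (x ∷ xs) zero = 0
part (x ∷ xs) (suc zero) = x
part (x ∷ xs) (suc (suc k)) = part xs (suc k)

oneTo : ℕ → List ℕ
oneTo n = map suc (upTo n)

maxList : List ℕ → ℕ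
maxList = foldr _⊔_ 0

conj : List ℕ → List ℕ
conj μ = map (λ i → length (filter (λ x → i ≤? x) μ)) (oneTo (part μ 1))

durfeeJ : ℕ → List ℕ → ℕ
durfeeJ m λs with suc m ≤? length λs
... | yes _ = maxList (filter (λ k → k ≤? part λs (k + m)) (oneTo (length λs)))
... | no _ = 0

durfeeα : ℕ → List ℕ → List ℕ
durfeeα m λs = conj (filter (λ x → 1 ≤? x) (map (λ r → part λs r ∸ j) (oneTo (m + j))))
  where j = durfeeJ m λs

durfeeβ : ℕ → List ℕ → List ℕ
durfeeβ m λs = map (λ r → part λs (m + durfeeJ m λs + r)) (oneTo (length λs ∸ (m + durfeeJ m λs)))

-- By the choice of j, the first m + j rows of λ all have length at least j, so for k < m
-- deleting the first j columns turns λ_k > λ_{k+1} into the same strict descent of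
-- μ = (λ_1 − j, …, λ_{m+j} − j).  For any partition μ, k is a part of μ' exactly when
-- μ_k > μ_{k+1}, since μ'_i = k holds precisely for μ_{k+1} < i ≤ μ_k.
module Submission where

open import Defs
open import Data.Nat using (ℕ; zero; suc; _+_; _∸_; _≤_; _<_; _>_; _≥_; _≤?_; z≤n; s≤s; s≤s⁻¹)
open import Data.Nat.Properties
open import Data.List using (List; []; _∷_; length; map; filter; applyUpTo)
open import Data.List.Properties using (filter-accept; filter-reject; map-applyUpTo; map-upTo)
open import Data.List.Membership.Propositional using (_∈_)
open import Data.List.Membership.Propositional.Properties
  using (∈-applyUpTo⁺; ∈-applyUpTo⁻; ∈-filter⁻; foldr-selective)
open import Data.List.Relation.Unary.Linked as Linked using (Linked; [-]; _∷_)
open import Data.List.Relation.Unary.Linked.Properties using (applyUpTo⁺₂; filter⁺)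
open import Data.Product using (_×_; _,_; proj₂)
open import Data.Sum using (_⊎_; inj₁; inj₂)
open import Data.Empty using (⊥-elim)
open import Relation.Nullary using (yes; no)
open import Relation.Binary.PropositionalEquality using (_≡_; refl; sym; trans; cong; cong₂; subst)
open import Function.Bundles using (_⇔_; mk⇔; Equivalence)
import Function.Properties.Equivalence as ⇔
open import Function.Related.Propositional using (module EquationalReasoning)

private
  variable
    x : ℕ
    xs μ : List ℕ

count : ℕ → List ℕ → ℕ
count i μ = length (filter (λ x → i ≤? x) μ)

part-tail≤head : Linked _≥_ (x ∷ xs) → ∀ k → part xs (suc k) ≤ x
part-tail≤head {xs = []} _ k = z≤n
part-tail≤head {xs = _ ∷ _} (x≥y ∷ _) zero = x≥y
part-tail≤head {xs = _ ∷ _} (x≥y ∷ l) (suc k) = ≤-trans (part-tail≤head l k) x≥y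

part-antitone : Linked _≥_ μ → ∀ {a b} → 0 < a → a ≤ b → part μ b ≤ part μ a
part-antitone {[]} _ _ _ = z≤n
part-antitone {_ ∷ _} _ {suc zero} {suc zero} _ _ = ≤-refl
part-antitone {_ ∷ _} l {suc zero} {suc (suc b)} _ _ = part-tail≤head l b
part-antitone {_ ∷ _} l {suc (suc a)} {suc (suc b)} _ (s≤s a≤b) =
  part-antitone (Linked.tail l) (s≤s z≤n) a≤b

part≤head : Linked _≥_ μ → ∀ k → part μ (suc k) ≤ part μ 1
part≤head l k = part-antitone l (s≤s z≤n) (s≤s z≤n)

part-applyUpTo : ∀ (f : ℕ → ℕ) {n k} → k < n → part (applyUpTo f n) (suc k) ≡ f k
part-applyUpTo f {suc n} {zero} _ = refl
part-applyUpTo f {suc n} {suc k} (s≤s k<n) = part-applyUpTo (λ i → f (suc i)) k<n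

-- Only the zero parts at the end of a weakly decreasing list are dropped.
part-filter-positive : Linked _≥_ μ → ∀ k → part (filter (λ x → 1 ≤? x) μ) (suc k) ≡ part μ (suc k)
part-filter-positive {[]} _ _ = refl
part-filter-positive {x ∷ xs} l k with 1 ≤? x
part-filter-positive {x ∷ xs} l zero | yes x>0
  rewrite filter-accept (λ x → 1 ≤? x) {x} {xs} x>0 = refl
part-filter-positive {x ∷ xs} l (suc k) | yes x>0
  rewrite filter-accept (λ x → 1 ≤? x) {x} {xs} x>0 = part-filter-positive (Linked.tail l) k
part-filter-positive {x ∷ xs} l k | no x≯0
  rewrite filter-reject (λ x → 1 ≤? x) {x} {xs} x≯0 =
    trans (part-filter-positive (Linked.tail l) k) (trans (≤0 (part-tail≤head l k))
          (sym (≤0 (part≤head l k))))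
  where
  ≤0 : ∀ {y} → y ≤ x → y ≡ 0
  ≤0 y≤x = n≤0⇒n≡0 (≤-trans y≤x (≮⇒≥ x≯0))

count-≥⇔part-≥ : Linked _≥_ μ → ∀ i k → suc k ≤ count (suc i) μ ⇔ suc i ≤ part μ (suc k)
count-≥⇔part-≥ {[]} _ i k = mk⇔ (λ ()) (λ ())
count-≥⇔part-≥ {x ∷ xs} l i k with suc i ≤? x
count-≥⇔part-≥ {x ∷ xs} l i zero | yes i<x
  rewrite filter-accept (λ x → suc i ≤? x) {x} {xs} i<x = mk⇔ (λ _ → i<x) (λ _ → s≤s z≤n)
count-≥⇔part-≥ {x ∷ xs} l i (suc k) | yes i<x
  rewrite filter-accept (λ x → suc i ≤? x) {x} {xs} i<x =
    ⇔.trans (mk⇔ s≤s⁻¹ s≤s) (count-≥⇔part-≥ (Linked.tail l) i k)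
count-≥⇔part-≥ {x ∷ xs} l i k | no i≮x
  rewrite filter-reject (λ x → suc i ≤? x) {x} {xs} i≮x = mk⇔
    (λ k<c → ⊥-elim (i≮x (≤-trans (Equivalence.to (count-≥⇔part-≥ (Linked.tail l) i k) k<c)
                                   (part-tail≤head l k))))
    (λ i<p → ⊥-elim (i≮x (≤-trans i<p (part≤head l k))))

count≡⇔part-bounds : Linked _≥_ μ → ∀ i k →
  count (suc i) μ ≡ suc k ⇔ (part μ (suc (suc k)) ≤ i × i < part μ (suc k))
count≡⇔part-bounds {μ} l i k = mk⇔
  (λ c≡ → ≮⇒≥ (λ i<p → 1+n≰n (≤-trans (from (suc k) i<p) (≤-reflexive c≡)))
        , to k (≤-reflexive (sym c≡)))
  (λ (p≤i , i<p) → ≤-antisym (≮⇒≥ (λ k<c → <⇒≱ (to (suc k) k<c) p≤i)) (from k i<p))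
  where
  to : ∀ k → suc k ≤ count (suc i) μ → suc i ≤ part μ (suc k)
  to k = Equivalence.to (count-≥⇔part-≥ l i k)
  from : ∀ k → suc i ≤ part μ (suc k) → suc k ≤ count (suc i) μ
  from k = Equivalence.from (count-≥⇔part-≥ l i k)

conj≡applyUpTo : ∀ μ → conj μ ≡ applyUpTo (λ i → count (suc i) μ) (part μ 1)
conj≡applyUpTo μ = trans (cong (map (λ i → count i μ)) (map-upTo suc (part μ 1)))
                         (map-applyUpTo suc (λ i → count i μ) (part μ 1))

-- Witness for the backward direction: column i = μ_{k+2} + 1 has height exactly k + 1.
∈-conj⇔descent : Linked _≥_ μ → ∀ k → suc k ∈ conj μ ⇔ part μ (suc (suc k)) < part μ (suc k)
∈-conj⇔descent {μ} l k rewrite conj≡applyUpTo μ = mk⇔ to from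
  where
  to : suc k ∈ applyUpTo (λ i → count (suc i) μ) (part μ 1) → part μ (suc (suc k)) < part μ (suc k)
  to k∈ with i , _ , k≡c ← ∈-applyUpTo⁻ (λ i → count (suc i) μ) k∈
    with p≤i , i<p ← Equivalence.to (count≡⇔part-bounds l i k) (sym k≡c) = ≤-<-trans p≤i i<p
  from : part μ (suc (suc k)) < part μ (suc k) → suc k ∈ applyUpTo (λ i → count (suc i) μ) (part μ 1)
  from descent = subst (_∈ _) (Equivalence.from (count≡⇔part-bounds l i k) (≤-refl , descent))
                       (∈-applyUpTo⁺ (λ i → count (suc i) μ)
                                     (<-≤-trans descent (part≤head l k)))
    where i = part μ (suc (suc k))

durfeeJ≡0⊎≤part : ∀ m μ → durfeeJ m μ ≡ 0 ⊎ durfeeJ m μ ≤ part μ (durfeeJ m μ + m)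
durfeeJ≡0⊎≤part m μ with suc m ≤? length μ
... | no _ = inj₁ refl
... | yes _ with foldr-selective ⊔-sel 0 (filter (λ k → k ≤? part μ (k + m)) (oneTo (length μ)))
...   | inj₁ j≡0 = inj₁ j≡0
...   | inj₂ j∈ = inj₂ (proj₂ (∈-filter⁻ (λ k → k ≤? part μ (k + m)) {xs = oneTo (length μ)} j∈))

durfeeJ≤part : Linked _≥_ μ → ∀ m {r} → 0 < r → r ≤ durfeeJ m μ + m → durfeeJ m μ ≤ part μ r
durfeeJ≤part {μ} l m r>0 r≤ with durfeeJ≡0⊎≤part m μ
... | inj₁ j≡0 rewrite j≡0 = z≤n
... | inj₂ j≤p = ≤-trans j≤p (part-antitone l r>0 r≤)

<⇔∸<∸ : ∀ {a b c} → c ≤ a → a < b ⇔ a ∸ c < b ∸ c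
<⇔∸<∸ {c = c} c≤a = mk⇔ (λ a<b → ∸-monoˡ-< a<b c≤a) (λ d → ≰⇒> (λ b≤a → <⇒≱ d (∸-monoˡ-≤ c b≤a)))

lemma2p3 : (m : ℕ) (λs : List ℕ) → IsPartition λs →
           (k : ℕ) → 1 ≤ k → k < m →
           (part λs k > part λs (suc k) ⇔ k ∈ durfeeα m λs)
lemma2p3 m λs (_ , λs↓) (suc k) _ k<m = begin
  part λs (suc (suc k)) < part λs (suc k)
    ∼⟨ <⇔∸<∸ (durfeeJ≤part λs↓ m (s≤s z≤n) k+2≤j+m) ⟩
  part λs (suc (suc k)) ∸ j < part λs (suc k) ∸ j
    ≡⟨ sym (cong₂ _<_ (part-shifted⁺ (suc k) k+2≤j+m) (part-shifted⁺ k (<⇒≤ k+2≤j+m))) ⟩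
  part shifted⁺ (suc (suc k)) < part shifted⁺ (suc k)
    ∼⟨ ⇔.sym (∈-conj⇔descent shifted⁺↓ k) ⟩
  suc k ∈ conj shifted⁺
    ≡⟨ cong (λ μ → suc k ∈ conj (filter (λ x → 1 ≤? x) μ)) shifted≡ ⟩
  suc k ∈ durfeeα m λs ∎
  where
  open EquationalReasoning
  j : ℕ
  j = durfeeJ m λs
  shifted shifted⁺ : List ℕ
  shifted = applyUpTo (λ r → part λs (suc r) ∸ j) (m + j)
  shifted⁺ = filter (λ x → 1 ≤? x) shifted
  shifted≡ : shifted ≡ map (λ r → part λs r ∸ j) (oneTo (m + j))
  shifted≡ = sym (trans (cong (map (λ r → part λs r ∸ j)) (map-upTo suc (m + j)))
                        (map-applyUpTo suc (λ r → part λs r ∸ j) (m + j)))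
  shifted↓ : Linked _≥_ shifted
  shifted↓ = applyUpTo⁺₂ _ (m + j)
    (λ r → ∸-monoˡ-≤ j (part-antitone λs↓ (s≤s z≤n) (n≤1+n (suc r))))
  shifted⁺↓ : Linked _≥_ shifted⁺
  shifted⁺↓ = filter⁺ (λ x → 1 ≤? x) (λ a≥b b≥c → ≤-trans b≥c a≥b) shifted↓
  k+2≤j+m : suc (suc k) ≤ j + m
  k+2≤j+m = ≤-trans k<m (m≤n+m m j)
  part-shifted⁺ : ∀ r → suc r ≤ j + m → part shifted⁺ (suc r) ≡ part λs (suc r) ∸ j
  part-shifted⁺ r r<j+m = trans (part-filter-positive shifted↓ r)
                                (part-applyUpTo _ (≤-trans r<j+m (≤-reflexive (+-comm j m))))
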